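{- For every formula $A$ of $\mathscr{L}$, $\models A \vee \neg A$, i.e. $\models_{\mathfrak{B}} A \vee \neg A$ for every (consistent) atomic base $\mathfrak{B}$.
   Context: The meta-language reasoning is classical. The language $\mathscr{L}$ has formulas generated by $X ::= p \mid \bot \mid X\wedge X \mid X \vee X \mid X \rightarrow X$, where $p$ ranges over propositional atoms; the $p$'s and $\bot$ are the atoms. $\neg A$ abbreviates $A \rightarrow \bot$. An atomic base $\mathfrak{B}$ is a countable set of production rules with premises $A_1,\dots,A_n$ ($n\ge 0$) and conclusion $B$, where $A_i, B$ are atoms and $A_i \neq \bot$; $\vdash_{\mathfrak{B}}$ denotes derivability of atoms from no assumptions using these rules. Bases are always required to be consistent: $\not\vdash_{\mathfrak{B}} \bot$. For a set of formulas $\Gamma$ and formula $A$, $\Gamma \models_{\mathfrak{B}} A$ is defined as follows. If $\Gamma=\emptyset$: for $A$ an atom, $\models_{\mathfrak{B}} A$ iff $\vdash_{\mathfrak{B}} A$; $\models_{\mathfrak{B}} B\wedge C$ iff $\models_{\mathfrak{B}} B$ and $\models_{\mathfrak{B}} C$; $\models_{\mathfrak{B}} B\vee C$ iff $\models_{\mathfrak{B}} B$ or $\models_{\mathfrak{B}} C$; $\models_{\mathfrak{B}} B\rightarrow C$ iff $\{B\} \models_{\mathfrak{B}} C$. If $\Gamma\neq\emptyset$: $\Gamma \models_{\mathfrak{B}} A$ iff (if $\models_{\mathfrak{B}} C$ for every $C\in\Gamma$, then $\models_{\mathfrak{B}} A$). Finally $\Gamma \models A$ iff $\Gamma \models_{\mathfrak{B}}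 A$ for every base $\mathfrak{B}$. -}

module Defs where

open import Data.Nat using (ℕ)
open import Data.List using (List; []; _∷_)
open import Data.List.Relation.Unary.All using (All)
open import Data.Product using (_×_)
open import Data.Sum using (_⊎_)
open import Data.Empty using ()
open import Relation.Nullary using (¬_)

data Atom : Set where
  prop : ℕ → Atom
  bot  : Atom

infixr 6 _∧'_
infixr 5 _∨'_
infixr 4 _⇒_
data Formula : Set where
  at   : Atom → Formula
  _∧'_ : Formula → Formula → Formula
  _∨'_ : Formula → Formula → Formula
  _⇒_  : Formula → Formula → Formula

⊥' : Formula
⊥' = at bot

¬' : Formula → Formula
¬' A = A ⇒ ⊥'

-- A production rule: premises A₁ … Aₙ (propositional atoms, never ⊥)
-- and a conclusion B (any atom, possibly ⊥).
record Rule : Set where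
  constructor rule
  field
    premises   : List ℕ
    conclusion : Atom
open Rule public

-- An atomic base is a set of rules (Rule is countable, so every such
-- set is countable).
Base : Set₁
Base = Rule → Set

data _⊢_ (𝔅 : Base) : Atom → Set where
  use : (r : Rule) → 𝔅 r →
        All (λ p → 𝔅 ⊢ prop p) (premises r) →
        𝔅 ⊢ conclusion r

Consistent : Base → Set
Consistent 𝔅 = ¬ (𝔅 ⊢ bot)

-- Support with Γ = ∅.  The clause for → is ⊨[𝔅] B → C iff {B} ⊨[𝔅] C,
-- and by the clause for nonempty Γ, {B} ⊨[𝔅] C unfolds to
-- (⊨[𝔅] B implies ⊨[𝔅] C), which is written out directly here.
⊨[_]_ : Base → Formula → Set
⊨[ 𝔅 ] at a     = 𝔅 ⊢ a
⊨[ 𝔅 ] (B ∧' C) = (⊨[ 𝔅 ] B) × (⊨[ 𝔅 ] C)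
⊨[ 𝔅 ] (B ∨' C) = (⊨[ 𝔅 ] B) ⊎ (⊨[ 𝔅 ] C)
⊨[ 𝔅 ] (B ⇒ C)  = ⊨[ 𝔅 ] B → ⊨[ 𝔅 ] C

⊨_ : Formula → Set₁
⊨ A = (𝔅 : Base) → Consistent 𝔅 → ⊨[ 𝔅 ] A

{-# OPTIONS --safe #-}
module Submission where

open import Defs
open import Level using (0ℓ)
open import Axiom.ExcludedMiddle using (ExcludedMiddle)
open import Data.Sum using (inj₁; inj₂)
open import Relation.Nullary using (¬_; Dec; yes; no)
open import Relation.Nullary.Negation using (contradiction)

module _ {𝔅 : Base} {A : Formula} where

  ¬⊨⇒⊨¬' : ¬ (⊨[ 𝔅 ] A) → ⊨[ 𝔅 ] ¬' A
  ¬⊨⇒⊨¬' ¬⊨A ⊨A = contradiction ⊨A ¬⊨A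

  dec⇒⊨∨¬' : Dec (⊨[ 𝔅 ] A) → ⊨[ 𝔅 ] (A ∨' ¬' A)
  dec⇒⊨∨¬' (yes ⊨A)  = inj₁ ⊨A
  dec⇒⊨∨¬' (no ¬⊨A) = inj₂ (¬⊨⇒⊨¬' ¬⊨A)

proposition2 : ExcludedMiddle 0ℓ → (A : Formula) → ⊨ (A ∨' ¬' A)
proposition2 em A 𝔅 _ = dec⇒⊨∨¬' em
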